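{- Let $m,n$ be integers with $1\le m<n$ and $n\le 2m+1$. Then the metric dimension of the Villarceau grid Type II satisfies $\dim(VG^2_{m,n})>2$.
   Context: For a connected graph $G$ and an ordered set $R=\{r_1,\dots,r_l\}\subseteq V(G)$, the code of a vertex $s$ is $(d(s,r_1),\dots,d(s,r_l))$, where $d$ is the shortest-path distance. $R$ is a resolving set if distinct vertices have distinct codes; $\dim(G)$ is the minimum cardinality of a resolving set. For integers $1\le m<n$, the Villarceau grid Type II $VG^2_{m,n}$ is the graph with vertex set $\{(2i+1,2j+1): i\in\{0,\dots,n-2\},\ j\in\{0,\dots,m-1\}\}\cup\{(2i,2j): i\in\{0,\dots,n-1\},\ j\in\{0,\dots,m\}\}$, in which $(i_1,j_1)$ and $(i_2,j_2)$ are adjacent if and only if $|i_1-i_2|=1$ and $|j_1-j_2|=1$. -}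

module Defs where

open import Data.Nat using (ℕ; zero; suc; _+_; _*_; _∸_; _≤_; _<_; ∣_-_∣)
open import Data.Product using (_×_; _,_; ∃-syntax)
open import Data.Sum using (_⊎_)
open import Data.List using (List; length)
open import Data.List.Relation.Unary.All using (All)
open import Relation.Binary.PropositionalEquality using (_≡_)

Point : Set
Point = ℕ × ℕ

data Vertex (m n : ℕ) : Point → Set where
  odd  : ∀ i j → suc i < n → j < m → Vertex m n (suc (2 * i) , suc (2 * j))
  even : ∀ i j → i < n → j ≤ m → Vertex m n (2 * i , 2 * j)

Adj : Point → Point → Set
Adj (x₁ , y₁) (x₂ , y₂) = (∣ x₁ - x₂ ∣ ≡ 1) × (∣ y₁ - y₂ ∣ ≡ 1)

data Walk (m n : ℕ) : Point → Point → ℕ → Set where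
  here : ∀ {s} → Vertex m n s → Walk m n s s 0
  step : ∀ {s u t k} → Vertex m n s → Adj s u → Walk m n u t k → Walk m n s t (suc k)

Dist : ℕ → ℕ → Point → Point → ℕ → Set
Dist m n s t k = Walk m n s t k × (∀ k′ → Walk m n s t k′ → k ≤ k′)

SameCode : ℕ → ℕ → List Point → Point → Point → Set
SameCode m n R s t = All (λ r → ∀ k → (Dist m n s r k → Dist m n t r k) × (Dist m n t r k → Dist m n s r k)) R

Resolving : ℕ → ℕ → List Point → Set
Resolving m n R =
  All (Vertex m n) R ×
  (∀ s t → Vertex m n s → Vertex m n t → SameCode m n R s t → s ≡ t)

-- The vertices of VG²_{m,n} are the points of [0, 2(n-1)] × [0, 2m] whose coordinates
-- have equal parity, and every edge is a diagonal unit step, so the graph distance is the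
-- Chebyshev distance max(|Δx|, |Δy|): a walk cannot be shorter, and moving both
-- coordinates towards the target realises it.
--
-- Two vertices (x, y) and (x, y + 2) are both at distance |x - rₓ| from every landmark r
-- lying in their horizontal cones {|Δy| ≤ |Δx|}. Given landmarks r₁ and r₂, after
-- swapping them and transposing the board, r₂ lies in the right cone of r₁. Right cones
-- are transitive, so such a vertical pair can be taken just left of r₁, or just right of
-- r₂, or, when r₁ and r₂ lie on the left and right edges, between them. The remaining
-- configurations (opposite corners of a square, a board of width 2) have explicit pairs.

module Submission where

open import Defs
open import Data.Nat using (ℕ; _+_; _*_; _≤_; _<_)
open import Data.List using (List; length)
open import Data.List.Relation.Unary.Unique.Propositional using (Unique)

open import Data.Nat using (zero; suc; _∸_; _⊔_; ∣_-_∣; z≤n; s≤s; s≤s⁻¹; parity)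
open import Data.Nat.Properties
open import Data.Parity.Base using (0ℙ; _⁻¹) renaming (_+_ to _+ℙ_)
open import Data.Parity.Properties
  using (⁻¹-selfInverse; ⁻¹-injective; p≢p⁻¹; suc-homo-⁻¹; +-homo-+; *-homo-*)
open import Data.Product using (Σ-syntax; _×_; _,_; proj₁; proj₂; swap)
open import Data.Sum using (_⊎_; inj₁; inj₂)
open import Data.Empty using (⊥-elim)
open import Data.List using ([]; _∷_)
open import Data.List.Relation.Unary.All as All using (All; []; _∷_)
open import Data.List.Relation.Unary.Any using (here; there)
open import Data.List.Membership.Propositional using (_∈_)
open import Data.List.Relation.Binary.Subset.Propositional using (_⊆_)
open import Relation.Nullary using (¬_)
open import Relation.Binary.Definitions using (tri<; tri≈; tri>)
open import Relation.Binary.PropositionalEquality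
open import Function using (_∘_; id)

private variable
  W H a b b₁ b₂ k w : ℕ
  p q r r₁ r₂ : Point
  R : List Point
  P Q : Point → Set

∣n-k+n∣≡k : ∀ k n → ∣ n - k + n ∣ ≡ k
∣n-k+n∣≡k k n = trans (cong (∣ n -_∣) (+-comm k n)) (∣m-m+n∣≡n n k)

∣k+n-n∣≡k : ∀ k n → ∣ k + n - n ∣ ≡ k
∣k+n-n∣≡k k n = trans (∣-∣-comm (k + n) n) (∣n-k+n∣≡k k n)

m≤o+n⇒n≤o+m⇒∣m-n∣≤o : ∀ {m n o} → m ≤ o + n → n ≤ o + m → ∣ m - n ∣ ≤ o
m≤o+n⇒n≤o+m⇒∣m-n∣≤o {m} {n} {o} m≤o+n n≤o+m with ∣m-n∣≡[m∸n]∨[n∸m] m n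
... | inj₁ eq = subst (_≤ o) (sym eq) (m≤n+o⇒m∸n≤o m n (subst (m ≤_) (+-comm o n) m≤o+n))
... | inj₂ eq = subst (_≤ o) (sym eq) (m≤n+o⇒m∸n≤o n m (subst (n ≤_) (+-comm o m) n≤o+m))

∣m-n∣≤o⇒n≤o+m : ∀ {m n o} → ∣ m - n ∣ ≤ o → n ≤ o + m
∣m-n∣≤o⇒n≤o+m {m} {n} d≤o =
  ≤-trans (m≤∣m-n∣+n n m) (+-monoˡ-≤ m (subst (_≤ _) (∣-∣-comm m n) d≤o))

∣m-n∣≤o⇒m≤o+n : ∀ {m n o} → ∣ m - n ∣ ≤ o → m ≤ o + n
∣m-n∣≤o⇒m≤o+n {m} {n} d≤o = ≤-trans (m≤∣m-n∣+n m n) (+-monoˡ-≤ n d≤o)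

parity-suc : ∀ n → parity (suc n) ≡ parity n ⁻¹
parity-suc n = sym (⁻¹-selfInverse (suc-homo-⁻¹ n))

parity-suc-injective : parity (suc a) ≡ parity (suc b) → parity a ≡ parity b
parity-suc-injective {a} {b} e = ⁻¹-injective (trans (sym (parity-suc a)) (trans e (parity-suc b)))

parity-double : ∀ i → parity (2 * i) ≡ 0ℙ
parity-double i = *-homo-* 2 i

∣m-n∣≡1⇒parity-flip : ∀ m n → ∣ m - n ∣ ≡ 1 → parity n ≡ parity m ⁻¹
∣m-n∣≡1⇒parity-flip zero    (suc zero) _ = refl
∣m-n∣≡1⇒parity-flip (suc zero) zero    _ = refl
∣m-n∣≡1⇒parity-flip (suc m) (suc n) e =
  trans (parity-suc n) (cong _⁻¹ (trans (∣m-n∣≡1⇒parity-flip m n e) (sym (parity-suc m))))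
∣m-n∣≡1⇒parity-flip zero    zero ()
∣m-n∣≡1⇒parity-flip zero    (suc (suc n)) ()
∣m-n∣≡1⇒parity-flip (suc (suc m)) zero ()

parity≡⇒∣m-n∣≢1 : ∀ m n → parity m ≡ parity n → ∣ m - n ∣ ≢ 1
parity≡⇒∣m-n∣≢1 m n e d = p≢p⁻¹ (parity m) (trans e (∣m-n∣≡1⇒parity-flip m n d))

parity-+-even : ∀ a b → parity a ≡ 0ℙ → parity (a + b) ≡ parity b
parity-+-even a b e = trans (+-homo-+ a b) (cong (_+ℙ parity b) e)

parity≡∧<⇒2+≤ : parity a ≡ parity b → a < b → 2 + a ≤ b
parity≡∧<⇒2+≤ {zero}  {suc zero}    () _
parity≡∧<⇒2+≤ {zero}  {suc (suc b)} _  _ = s≤s (s≤s z≤n)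
parity≡∧<⇒2+≤ {suc a} {suc b}       e  (s≤s a<b) =
  s≤s (parity≡∧<⇒2+≤ (parity-suc-injective {a} {b} e) a<b)

even∧<⇒2+≤ : parity a ≡ 0ℙ → parity b ≡ 0ℙ → a < b → 2 + a ≤ b
even∧<⇒2+≤ a-even b-even = parity≡∧<⇒2+≤ (trans a-even (sym b-even))

OnBoard : ℕ → ℕ → Point → Set
OnBoard W H (x , y) = x ≤ W × y ≤ H × parity x ≡ parity y

onBoard-swap : OnBoard W H p → OnBoard H W (swap p)
onBoard-swap (x≤ , y≤ , e) = y≤ , x≤ , sym e

data Halving : ℕ → Set where
  double   : ∀ i → Halving (2 * i)
  double+1 : ∀ i → Halving (suc (2 * i))

halving : ∀ x → Halving x
halving zero = double 0
halving (suc x) with halving x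
... | double i   = double+1 i
... | double+1 i = subst Halving (*-suc 2 i) (double (suc i))

parity-double+1 : ∀ i → parity (suc (2 * i)) ≡ 0ℙ ⁻¹
parity-double+1 i = trans (parity-suc (2 * i)) (cong _⁻¹ (parity-double i))

parity-double≢double+1 : ∀ i j → parity (2 * i) ≢ parity (suc (2 * j))
parity-double≢double+1 i j e =
  p≢p⁻¹ 0ℙ (trans (sym (parity-double i)) (trans e (parity-double+1 j)))

module _ {m n : ℕ} where

  vertex⇒onBoard : Vertex m (suc n) p → OnBoard (2 * n) (2 * m) p
  vertex⇒onBoard (odd i j (s≤s i<n) j<m) =
    *-monoʳ-< 2 i<n , *-monoʳ-< 2 j<m , trans (parity-double+1 i) (sym (parity-double+1 j))
  vertex⇒onBoard (even i j (s≤s i≤n) j≤m) =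
    *-monoʳ-≤ 2 i≤n , *-monoʳ-≤ 2 j≤m , trans (parity-double i) (sym (parity-double j))

  onBoard⇒vertex : OnBoard (2 * n) (2 * m) p → Vertex m (suc n) p
  onBoard⇒vertex {x , y} (x≤ , y≤ , e) with halving x | halving y
  ... | double i   | double j   = even i j (s≤s (*-cancelˡ-≤ 2 x≤)) (*-cancelˡ-≤ 2 y≤)
  ... | double+1 i | double+1 j = odd i j (s≤s (*-cancelˡ-< 2 i n x≤)) (*-cancelˡ-< 2 j m y≤)
  ... | double i   | double+1 j = ⊥-elim (parity-double≢double+1 i j e)
  ... | double+1 i | double j   = ⊥-elim (parity-double≢double+1 j i (sym e))

cheb : Point → Point → ℕ
cheb (x₁ , y₁) (x₂ , y₂) = ∣ x₁ - x₂ ∣ ⊔ ∣ y₁ - y₂ ∣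

cheb-swap : ∀ p q → cheb (swap p) (swap q) ≡ cheb p q
cheb-swap (x₁ , y₁) (x₂ , y₂) = ⊔-comm ∣ y₁ - y₂ ∣ ∣ x₁ - x₂ ∣

cheb-self : ∀ p → cheb p p ≡ 0
cheb-self (x , y) = cong₂ _⊔_ (∣n-n∣≡0 x) (∣n-n∣≡0 y)

cheb≡0⇒≡ : cheb p q ≡ 0 → p ≡ q
cheb≡0⇒≡ {x₁ , y₁} {x₂ , y₂} d≡0 =
  cong₂ _,_ (∣m-n∣≡0⇒m≡n (n≤0⇒n≡0 (≤-trans (m≤m⊔n _ _) (≤-reflexive d≡0))))
            (∣m-n∣≡0⇒m≡n (n≤0⇒n≡0 (≤-trans (m≤n⊔m _ _) (≤-reflexive d≡0))))

cheb-triangle : ∀ p q r → cheb p r ≤ cheb p q + cheb q r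
cheb-triangle (x₁ , y₁) (x₂ , y₂) (x₃ , y₃) = ⊔-lub
  (≤-trans (∣-∣-triangle x₁ x₂ x₃)
           (+-mono-≤ (m≤m⊔n ∣ x₁ - x₂ ∣ ∣ y₁ - y₂ ∣) (m≤m⊔n ∣ x₂ - x₃ ∣ ∣ y₂ - y₃ ∣)))
  (≤-trans (∣-∣-triangle y₁ y₂ y₃)
           (+-mono-≤ (m≤n⊔m ∣ x₁ - x₂ ∣ ∣ y₁ - y₂ ∣) (m≤n⊔m ∣ x₂ - x₃ ∣ ∣ y₂ - y₃ ∣)))

cheb-adj : Adj p q → cheb p q ≡ 1
cheb-adj (dx , dy) = cong₂ _⊔_ dx dy

cheb≤length : ∀ {m n} → Walk m n p q k → cheb p q ≤ k
cheb≤length {p} (here _) = ≤-reflexive (cheb-self p)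
cheb≤length {p} {q} {suc k} (step {u = u} _ adj w) = begin
  cheb p q             ≤⟨ cheb-triangle p u q ⟩
  cheb p u + cheb u q  ≡⟨ cong (_+ cheb u q) (cheb-adj {p} {u} adj) ⟩
  suc (cheb u q)       ≤⟨ s≤s (cheb≤length w) ⟩
  suc k                ∎
  where open ≤-Reasoning

column-cheb≢1 : OnBoard W H p → OnBoard W H q → proj₁ p ≡ proj₁ q → cheb p q ≢ 1
column-cheb≢1 {p = x , y₁} {q = .x , y₂} (_ , _ , e₁) (_ , _ , e₂) refl d≡1 =
  parity≡⇒∣m-n∣≢1 y₁ y₂ (trans (sym e₁) e₂)
    (trans (cong (_⊔ ∣ y₁ - y₂ ∣) (sym (∣n-n∣≡0 x))) d≡1)

row-cheb≢1 : OnBoard W H p → OnBoard W H q → proj₂ p ≡ proj₂ q → cheb p q ≢ 1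
row-cheb≢1 {p = p} {q = q} p-on q-on y≡ d≡1 =
  column-cheb≢1 (onBoard-swap p-on) (onBoard-swap q-on) y≡ (trans (cheb-swap p q) d≡1)

∣m-n∣≡1+∣1+m-n∣ : a < b → ∣ a - b ∣ ≡ suc ∣ suc a - b ∣
∣m-n∣≡1+∣1+m-n∣ {zero}  {suc b} _         = refl
∣m-n∣≡1+∣1+m-n∣ {suc a} {suc b} (s≤s a<b) = ∣m-n∣≡1+∣1+m-n∣ a<b

-- A coordinate that already agrees with its target must still move, hence the slack d ≥ 1.
stepToward : ∀ {B x y d} → 1 ≤ B → x ≤ B → y ≤ B → ∣ x - y ∣ ≤ suc d → (x ≡ y → 1 ≤ d) →
             Σ[ x′ ∈ ℕ ] x′ ≤ B × ∣ x - x′ ∣ ≡ 1 × ∣ x′ - y ∣ ≤ d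
stepToward {B} {x} {y} {d} 1≤B x≤B y≤B close aligned with <-cmp x y
... | tri< x<y _ _ =
  suc x , ≤-trans x<y y≤B , ∣n-k+n∣≡k 1 x ,
  s≤s⁻¹ (subst (_≤ suc d) (∣m-n∣≡1+∣1+m-n∣ x<y) close)
stepToward {x = suc x} {y} {d} _ x≤B _ close _ | tri> _ _ (s≤s y≤x) =
  x , ≤-trans (n≤1+n x) x≤B , ∣k+n-n∣≡k 1 x ,
  s≤s⁻¹ (subst (_≤ suc d) ∣1+x-y∣≡1+∣x-y∣ close)
  where
    ∣1+x-y∣≡1+∣x-y∣ : ∣ suc x - y ∣ ≡ suc ∣ x - y ∣
    ∣1+x-y∣≡1+∣x-y∣ = trans (∣-∣-comm (suc x) y)
                            (trans (∣m-n∣≡1+∣1+m-n∣ (s≤s y≤x)) (cong suc (∣-∣-comm y x)))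
... | tri≈ _ refl _ with m≤n⇒m<n∨m≡n x≤B
...   | inj₁ x<B =
  suc x , x<B , ∣n-k+n∣≡k 1 x , subst (_≤ d) (sym (∣k+n-n∣≡k 1 x)) (aligned refl)
stepToward {suc B} {suc B} _ _ _ _ aligned | tri≈ _ refl _ | inj₂ refl =
  B , n≤1+n B , ∣k+n-n∣≡k 1 B , subst (_≤ _) (sym (∣n-k+n∣≡k 1 B)) (aligned refl)

record RightCone (p q : Point) : Set where
  constructor rightCone
  field
    spread : ∣ proj₂ p - proj₂ q ∣ + proj₁ p ≤ proj₁ q

record HorizontalCone (p q : Point) : Set where
  constructor horizontal
  field
    steep : ∣ proj₂ p - proj₂ q ∣ ≤ ∣ proj₁ p - proj₁ q ∣

horizontal-sym : HorizontalCone p q → HorizontalCone q p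
horizontal-sym {x₁ , y₁} {x₂ , y₂} (horizontal h) =
  horizontal (subst₂ _≤_ (∣-∣-comm y₁ y₂) (∣-∣-comm x₁ x₂) h)

cheb-horizontal : HorizontalCone p q → cheb p q ≡ ∣ proj₁ p - proj₁ q ∣
cheb-horizontal (horizontal h) = m≥n⇒m⊔n≡m h

rightCone⇒horizontal : RightCone p q → HorizontalCone p q
rightCone⇒horizontal {x₁ , y₁} {x₂ , y₂} (rightCone c) = horizontal
  (subst (∣ y₁ - y₂ ∣ ≤_) (sym (m≤n⇒∣m-n∣≡n∸m (m+n≤o⇒n≤o ∣ y₁ - y₂ ∣ c)))
         (m+n≤o⇒m≤o∸n ∣ y₁ - y₂ ∣ c))

horizontal⇒rightCone : HorizontalCone p q → proj₁ p ≤ proj₁ q → RightCone p q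
horizontal⇒rightCone {x₁ , y₁} {x₂ , y₂} (horizontal h) x₁≤x₂ = rightCone (begin
  ∣ y₁ - y₂ ∣ + x₁  ≤⟨ +-monoˡ-≤ x₁ h ⟩
  ∣ x₁ - x₂ ∣ + x₁  ≡⟨ cong (_+ x₁) (m≤n⇒∣m-n∣≡n∸m x₁≤x₂) ⟩
  x₂ ∸ x₁ + x₁      ≡⟨ m∸n+n≡m x₁≤x₂ ⟩
  x₂                ∎)
  where open ≤-Reasoning

rightCone-trans : RightCone p q → RightCone q r → RightCone p r
rightCone-trans {x₁ , y₁} {x₂ , y₂} {x₃ , y₃} (rightCone c₁) (rightCone c₂) = rightCone (begin
  ∣ y₁ - y₃ ∣ + x₁                 ≤⟨ +-monoˡ-≤ x₁ (∣-∣-triangle y₁ y₂ y₃) ⟩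
  ∣ y₁ - y₂ ∣ + ∣ y₂ - y₃ ∣ + x₁   ≡⟨ cong (_+ x₁) (+-comm ∣ y₁ - y₂ ∣ ∣ y₂ - y₃ ∣) ⟩
  ∣ y₂ - y₃ ∣ + ∣ y₁ - y₂ ∣ + x₁   ≡⟨ +-assoc ∣ y₂ - y₃ ∣ ∣ y₁ - y₂ ∣ x₁ ⟩
  ∣ y₂ - y₃ ∣ + (∣ y₁ - y₂ ∣ + x₁) ≤⟨ +-monoʳ-≤ ∣ y₂ - y₃ ∣ c₁ ⟩
  ∣ y₂ - y₃ ∣ + x₂                 ≤⟨ c₂ ⟩
  x₃                               ∎)
  where open ≤-Reasoning

horizontal⇒rightCone⊎ : HorizontalCone p q → RightCone p q ⊎ RightCone q p
horizontal⇒rightCone⊎ {x₁ , _} {x₂ , _} h with ≤-total x₁ x₂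
... | inj₁ x₁≤x₂ = inj₁ (horizontal⇒rightCone h x₁≤x₂)
... | inj₂ x₂≤x₁ = inj₂ (horizontal⇒rightCone (horizontal-sym h) x₂≤x₁)

cones-cover : ∀ p q → (RightCone p q ⊎ RightCone q p) ⊎
                      (RightCone (swap p) (swap q) ⊎ RightCone (swap q) (swap p))
cones-cover (x₁ , y₁) (x₂ , y₂) with ≤-total ∣ y₁ - y₂ ∣ ∣ x₁ - x₂ ∣
... | inj₁ h = inj₁ (horizontal⇒rightCone⊎ (horizontal h))
... | inj₂ h = inj₂ (horizontal⇒rightCone⊎ (horizontal h))

record Unresolved (W H : ℕ) (r₁ r₂ : Point) : Set where
  field
    s t   : Point
    s-on  : OnBoard W H s
    t-on  : OnBoard W H t
    s≢t   : s ≢ t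
    same₁ : cheb s r₁ ≡ cheb t r₁
    same₂ : cheb s r₂ ≡ cheb t r₂

unresolved-swap : Unresolved W H r₁ r₂ → Unresolved W H r₂ r₁
unresolved-swap u = record { Unresolved u ; same₁ = same₂ ; same₂ = same₁ }
  where open Unresolved u

unresolved-transpose : Unresolved H W (swap r₁) (swap r₂) → Unresolved W H r₁ r₂
unresolved-transpose {r₁ = r₁} {r₂ = r₂} u = record
  { s     = swap s
  ; t     = swap t
  ; s-on  = onBoard-swap s-on
  ; t-on  = onBoard-swap t-on
  ; s≢t   = λ e → s≢t (cong swap e)
  ; same₁ = trans (cheb-swap s (swap r₁)) (trans same₁ (sym (cheb-swap t (swap r₁))))
  ; same₂ = trans (cheb-swap s (swap r₂)) (trans same₂ (sym (cheb-swap t (swap r₂))))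
  }
  where open Unresolved u

record VerticalPair (W H : ℕ) (P : Point → Set) : Set where
  constructor verticalPair
  field
    x y      : ℕ
    on-board : OnBoard W H (x , y)
    fits     : 2 + y ≤ H
    lower    : P (x , y)
    upper    : P (x , 2 + y)

verticalPair-map : (∀ {p} → P p → Q p) → VerticalPair W H P → VerticalPair W H Q
verticalPair-map f (verticalPair x y on fits lower upper) =
  verticalPair x y on fits (f lower) (f upper)

unresolved-verticalPair : VerticalPair W H (λ p → HorizontalCone p r₁ × HorizontalCone p r₂) →
                          Unresolved W H r₁ r₂
unresolved-verticalPair (verticalPair x y (x≤ , y≤ , e) fits (h₁ , h₂) (h₁′ , h₂′)) = record
  { s     = x , y
  ; t     = x , 2 + y
  ; s-on  = x≤ , y≤ , e
  ; t-on  = x≤ , fits , e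
  ; s≢t   = λ eq → m≢1+n+m y (cong proj₂ eq)
  ; same₁ = trans (cheb-horizontal h₁) (sym (cheb-horizontal h₁′))
  ; same₂ = trans (cheb-horizontal h₂) (sym (cheb-horizontal h₂′))
  }

rightCone-≤ : ∀ {x₁ y₁ x₂ y₂} d → ∣ y₁ - y₂ ∣ ≤ d → d + x₁ ≤ x₂ → RightCone (x₁ , y₁) (x₂ , y₂)
rightCone-≤ {x₁} d dy≤d d+x₁≤x₂ = rightCone (≤-trans (+-monoˡ-≤ x₁ dy≤d) d+x₁≤x₂)

rightCone-≡ : ∀ {x₁ y₁ x₂ y₂} d → ∣ y₁ - y₂ ∣ ≡ d → d + x₁ ≤ x₂ → RightCone (x₁ , y₁) (x₂ , y₂)
rightCone-≡ d dy≡d = rightCone-≤ d (≤-reflexive dy≡d)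

pairLeftOf : parity H ≡ 0ℙ → 2 ≤ H → OnBoard W H (suc a , b) →
             VerticalPair W H (λ p → RightCone p (suc a , b))
pairLeftOf {a = zero}  {b = zero} _ _ (_ , _ , ())
pairLeftOf {a = suc a} {b = zero} _ 2≤H (a≤ , _ , e) =
  verticalPair a 0 (≤-trans (m≤n+m a 2) a≤ , z≤n , e) 2≤H
    (rightCone-≡ 0 refl (m≤n+m a 2)) (rightCone-≡ 2 refl ≤-refl)
pairLeftOf {a = a} {b = suc b} _ _ (a≤ , b≤ , e) with m≤n⇒m<n∨m≡n b≤
... | inj₁ b<H =
  verticalPair a b
    (≤-trans (n≤1+n a) a≤ , ≤-trans (n≤1+n b) b≤ , parity-suc-injective {a} {b} e) b<H
    (rightCone-≡ 1 (∣n-k+n∣≡k 1 b) ≤-refl) (rightCone-≡ 1 (∣k+n-n∣≡k 1 b) ≤-refl)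
pairLeftOf {b = suc zero} H-even _ _ | inj₂ refl with () ← H-even
pairLeftOf {a = zero}  {b = suc (suc b)} H-even _ (_ , _ , e) | inj₂ refl with () ← trans e H-even
pairLeftOf {a = suc a} {b = suc (suc b)} _ _ (a≤ , _ , e) | inj₂ refl =
  verticalPair a b (≤-trans (m≤n+m a 2) a≤ , m≤n+m b 2 , e) ≤-refl
    (rightCone-≡ 2 (∣n-k+n∣≡k 2 b) ≤-refl) (rightCone-≡ 0 (∣n-n∣≡0 b) (m≤n+m a 2))

pairRightOf : parity W ≡ 0ℙ → parity H ≡ 0ℙ → 2 ≤ H → a < W → OnBoard W H (a , b) →
              VerticalPair W H (RightCone (a , b))
pairRightOf {a = a} {b = zero} W-even _ 2≤H a<W (_ , _ , e) =
  verticalPair (2 + a) 0 (even∧<⇒2+≤ e W-even a<W , z≤n , e) 2≤H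
    (rightCone-≡ 0 refl (m≤n+m a 2)) (rightCone-≡ 2 refl ≤-refl)
pairRightOf {a = a} {b = suc b} _ _ _ a<W (_ , b≤ , e) with m≤n⇒m<n∨m≡n b≤
... | inj₁ b<H =
  verticalPair (suc a) b
    (a<W , ≤-trans (n≤1+n b) b≤ , trans (parity-suc a) (trans (cong _⁻¹ e) (suc-homo-⁻¹ b))) b<H
    (rightCone-≡ 1 (∣k+n-n∣≡k 1 b) ≤-refl) (rightCone-≡ 1 (∣n-k+n∣≡k 1 b) ≤-refl)
pairRightOf {b = suc zero} _ H-even _ _ _ | inj₂ refl with () ← H-even
pairRightOf {a = a} {b = suc (suc b)} W-even H-even _ a<W (_ , _ , e) | inj₂ refl =
  verticalPair (2 + a) b (even∧<⇒2+≤ (trans e H-even) W-even a<W , m≤n+m b 2 , e) ≤-refl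
    (rightCone-≡ 2 (∣k+n-n∣≡k 2 b) ≤-refl) (rightCone-≡ 0 (∣n-n∣≡0 b) (m≤n+m a 2))

Between : Point → Point → Point → Set
Between r₁ r₂ p = RightCone r₁ p × RightCone p r₂

unresolved-between : VerticalPair W H (Between r₁ r₂) → Unresolved W H r₁ r₂
unresolved-between = unresolved-verticalPair ∘ verticalPair-map
  (λ (c₁ , c₂) → horizontal-sym (rightCone⇒horizontal c₁) , rightCone⇒horizontal c₂)

risingPairBetween : OnBoard (2 + w) H (0 , b₁) → b₂ ≤ H → 2 + b₁ ≤ b₂ → 2 + b₂ ≤ (2 + w) + b₁ →
                    VerticalPair (2 + w) H (Between (0 , b₁) (2 + w , b₂))
risingPairBetween {w} {b₁ = b₁} {b₂} (_ , b₁≤H , e) b₂≤H gap₁ gap =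
  verticalPair 2 b₁ (s≤s (s≤s z≤n) , b₁≤H , e) (≤-trans gap₁ b₂≤H)
    (rightCone-≡ 0 (∣n-n∣≡0 b₁) z≤n , rightCone-≤ w lower-offset (≤-reflexive (+-comm w 2)))
    (rightCone-≡ 2 (∣n-k+n∣≡k 2 b₁) ≤-refl , rightCone-≤ w upper-offset (≤-reflexive (+-comm w 2)))
  where
    b₂≤w+b₁ : b₂ ≤ w + b₁
    b₂≤w+b₁ = s≤s⁻¹ (s≤s⁻¹ gap)
    lower-offset : ∣ b₁ - b₂ ∣ ≤ w
    lower-offset = m≤o+n⇒n≤o+m⇒∣m-n∣≤o (≤-trans (≤-trans (m≤n+m b₁ 2) gap₁) (m≤n+m b₂ w))
                                       b₂≤w+b₁
    upper-offset : ∣ 2 + b₁ - b₂ ∣ ≤ w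
    upper-offset = m≤o+n⇒n≤o+m⇒∣m-n∣≤o (≤-trans gap₁ (m≤n+m b₂ w))
                                       (≤-trans b₂≤w+b₁ (+-monoʳ-≤ w (m≤n+m b₁ 2)))

fallingPairBetween : b₁ ≤ H → OnBoard (2 + w) H (2 + w , b₂) → 2 + b₂ ≤ b₁ → 2 + b₁ ≤ (2 + w) + b₂ →
                     VerticalPair (2 + w) H (Between (0 , b₁) (2 + w , b₂))
fallingPairBetween {b₁ = b₁} {w = w} {b₂ = b₂} b₁≤H (_ , b₂≤H , e) gap₂ gap =
  verticalPair w b₂ (m≤n+m w 2 , b₂≤H , e) (≤-trans gap₂ b₁≤H)
    (rightCone-≤ w lower-offset (≤-reflexive (+-identityʳ w)) ,
     rightCone-≡ 0 (∣n-n∣≡0 b₂) (m≤n+m w 2))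
    (rightCone-≤ w upper-offset (≤-reflexive (+-identityʳ w)) ,
     rightCone-≡ 2 (∣k+n-n∣≡k 2 b₂) ≤-refl)
  where
    b₁≤w+b₂ : b₁ ≤ w + b₂
    b₁≤w+b₂ = s≤s⁻¹ (s≤s⁻¹ gap)
    lower-offset : ∣ b₁ - b₂ ∣ ≤ w
    lower-offset = m≤o+n⇒n≤o+m⇒∣m-n∣≤o b₁≤w+b₂
                                       (≤-trans (≤-trans (m≤n+m b₂ 2) gap₂) (m≤n+m b₁ w))
    upper-offset : ∣ b₁ - 2 + b₂ ∣ ≤ w
    upper-offset = m≤o+n⇒n≤o+m⇒∣m-n∣≤o (≤-trans b₁≤w+b₂ (+-monoʳ-≤ w (m≤n+m b₂ 2)))
                                       (≤-trans gap₂ (m≤n+m b₁ w))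

levelPairBetween : parity H ≡ 0ℙ → 2 ≤ H → OnBoard (4 + w) H (0 , b) →
                   VerticalPair (4 + w) H (Between (0 , b) (4 + w , b))
levelPairBetween {b = b} H-even _ (_ , b≤H , e) with m≤n⇒m<n∨m≡n b≤H
... | inj₁ b<H =
  verticalPair 2 b (s≤s (s≤s z≤n) , b≤H , e) (even∧<⇒2+≤ (sym e) H-even b<H)
    (rightCone-≡ 0 (∣n-n∣≡0 b) z≤n , rightCone-≡ 0 (∣n-n∣≡0 b) (s≤s (s≤s z≤n)))
    (rightCone-≡ 2 (∣n-k+n∣≡k 2 b) ≤-refl , rightCone-≡ 2 (∣k+n-n∣≡k 2 b) (m≤m+n 4 _))
levelPairBetween {b = zero}  _ () _ | inj₂ refl
levelPairBetween {b = suc zero} _ _ (_ , _ , ()) | inj₂ refl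
levelPairBetween {b = suc (suc b)} _ _ (_ , _ , e) | inj₂ refl =
  verticalPair 2 b (s≤s (s≤s z≤n) , m≤n+m b 2 , e) ≤-refl
    (rightCone-≡ 2 (∣k+n-n∣≡k 2 b) ≤-refl , rightCone-≡ 2 (∣n-k+n∣≡k 2 b) (m≤m+n 4 _))
    (rightCone-≡ 0 (∣n-n∣≡0 b) z≤n , rightCone-≡ 0 (∣n-n∣≡0 b) (s≤s (s≤s z≤n)))

-- With width 2 and landmarks at equal height only horizontal pairs work.
narrowPair : parity H ≡ 0ℙ → 2 ≤ H → OnBoard 2 H (0 , b) →
             VerticalPair H 2 (λ p → HorizontalCone p (b , 0) × HorizontalCone p (b , 2))
narrowPair {b = b} H-even _ (_ , b≤H , e) with m≤n⇒m<n∨m≡n b≤H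
... | inj₁ b<H =
  verticalPair (2 + b) 0 (even∧<⇒2+≤ (sym e) H-even b<H , z≤n , sym e) ≤-refl
    (horizontal z≤n , horizontal (≤-reflexive (sym (∣k+n-n∣≡k 2 b))))
    (horizontal (≤-reflexive (sym (∣k+n-n∣≡k 2 b))) , horizontal z≤n)
narrowPair {b = zero}  _ () _ | inj₂ refl
narrowPair {b = suc zero} _ _ (_ , _ , ()) | inj₂ refl
narrowPair {b = suc (suc b)} _ _ (_ , _ , e) | inj₂ refl =
  verticalPair b 0 (m≤n+m b 2 , z≤n , sym e) ≤-refl
    (horizontal z≤n , horizontal (≤-reflexive (sym (∣n-k+n∣≡k 2 b))))
    (horizontal (≤-reflexive (sym (∣n-k+n∣≡k 2 b))) , horizontal z≤n)

-- No vertical pair works for opposite corners of a square; (2, b) and (0, 2 + b) do.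
unresolved-diagonal : OnBoard (2 + w) H (0 , b) → OnBoard (2 + w) H (2 + w , (2 + w) + b) →
                      Unresolved (2 + w) H (0 , b) (2 + w , (2 + w) + b)
unresolved-diagonal {w} {b = b} (_ , b≤H , e) (_ , top , _) = record
  { s     = 2 , b
  ; t     = 0 , 2 + b
  ; s-on  = s≤s (s≤s z≤n) , b≤H , e
  ; t-on  = z≤n , ≤-trans (+-monoˡ-≤ b (m≤m+n 2 w)) top , e
  ; s≢t   = λ ()
  ; same₁ = trans (cong (2 ⊔_) (∣n-n∣≡0 b)) (sym (∣k+n-n∣≡k 2 b))
  ; same₂ = begin
      w ⊔ ∣ b - (2 + w) + b ∣  ≡⟨ cong (w ⊔_) (∣n-k+n∣≡k (2 + w) b) ⟩
      w ⊔ (2 + w)              ≡⟨ ⊔-comm w (2 + w) ⟩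
      (2 + w) ⊔ w              ≡⟨ cong ((2 + w) ⊔_) (∣n-k+n∣≡k w b) ⟨
      (2 + w) ⊔ ∣ b - w + b ∣  ∎
  }
  where open ≡-Reasoning

unresolved-antidiagonal : OnBoard (2 + w) H (0 , (2 + w) + b) →
                          Unresolved (2 + w) H (0 , (2 + w) + b) (2 + w , b)
unresolved-antidiagonal {w} {b = b} (_ , top , e) = record
  { s     = 0 , w + b
  ; t     = 2 , (2 + w) + b
  ; s-on  = z≤n , ≤-trans (m≤n+m (w + b) 2) top , e
  ; t-on  = s≤s (s≤s z≤n) , top , e
  ; s≢t   = λ ()
  ; same₁ = trans (∣n-k+n∣≡k 2 (w + b)) (sym (cong (2 ⊔_) (∣n-n∣≡0 ((2 + w) + b))))
  ; same₂ = begin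
      (2 + w) ⊔ ∣ w + b - b ∣      ≡⟨ cong ((2 + w) ⊔_) (∣k+n-n∣≡k w b) ⟩
      (2 + w) ⊔ w                  ≡⟨ ⊔-comm (2 + w) w ⟩
      w ⊔ (2 + w)                  ≡⟨ cong (w ⊔_) (∣k+n-n∣≡k (2 + w) b) ⟨
      w ⊔ ∣ (2 + w) + b - b ∣      ∎
  }
  where open ≡-Reasoning

unresolved-oppositeSides : parity (2 + w) ≡ 0ℙ → parity H ≡ 0ℙ → 2 ≤ H →
                           OnBoard (2 + w) H (0 , b₁) → OnBoard (2 + w) H (2 + w , b₂) →
                           ∣ b₁ - b₂ ∣ ≤ 2 + w → Unresolved (2 + w) H (0 , b₁) (2 + w , b₂)
unresolved-oppositeSides {w} {b₁ = b₁} {b₂ = b₂}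
  W-even H-even 2≤H r₁-on@(_ , b₁≤H , e₁) r₂-on@(_ , b₂≤H , e₂) close with <-cmp b₁ b₂
... | tri< b₁<b₂ _ _ with m≤n⇒m<n∨m≡n (∣m-n∣≤o⇒n≤o+m close)
...   | inj₁ b₂<W+b₁ =
  unresolved-between (risingPairBetween r₁-on b₂≤H
    (even∧<⇒2+≤ (sym e₁) (trans (sym e₂) W-even) b₁<b₂)
    (even∧<⇒2+≤ (trans (sym e₂) W-even) (trans (parity-+-even (2 + w) b₁ W-even) (sym e₁)) b₂<W+b₁))
...   | inj₂ refl = unresolved-diagonal r₁-on r₂-on
unresolved-oppositeSides {w} {b₁ = b₁} {b₂ = b₂}
  W-even H-even 2≤H r₁-on@(_ , b₁≤H , e₁) r₂-on@(_ , b₂≤H , e₂) close | tri> _ _ b₂<b₁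
  with m≤n⇒m<n∨m≡n (∣m-n∣≤o⇒m≤o+n close)
...   | inj₁ b₁<W+b₂ =
  unresolved-between (fallingPairBetween b₁≤H r₂-on
    (even∧<⇒2+≤ (trans (sym e₂) W-even) (sym e₁) b₂<b₁)
    (even∧<⇒2+≤ (sym e₁) (trans (parity-+-even (2 + w) b₂ W-even) (trans (sym e₂) W-even)) b₁<W+b₂))
...   | inj₂ refl = unresolved-antidiagonal r₁-on
unresolved-oppositeSides {zero} _ H-even 2≤H r₁-on _ _ | tri≈ _ refl _ =
  unresolved-transpose (unresolved-verticalPair (narrowPair H-even 2≤H r₁-on))
unresolved-oppositeSides {suc zero} W-even _ _ _ _ _ | tri≈ _ refl _ with () ← W-even
unresolved-oppositeSides {suc (suc w)} _ H-even 2≤H r₁-on _ _ | tri≈ _ refl _ =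
  unresolved-between (levelPairBetween H-even 2≤H r₁-on)

unresolved-rightCone : parity W ≡ 0ℙ → parity H ≡ 0ℙ → 2 ≤ W → 2 ≤ H →
                       OnBoard W H r₁ → OnBoard W H r₂ → RightCone r₁ r₂ → Unresolved W H r₁ r₂
unresolved-rightCone {r₁ = suc a , b} _ H-even _ 2≤H r₁-on _ c =
  unresolved-verticalPair (verticalPair-map
    (λ c₁ → rightCone⇒horizontal c₁ , rightCone⇒horizontal (rightCone-trans c₁ c))
    (pairLeftOf H-even 2≤H r₁-on))
unresolved-rightCone {r₁ = zero , _} {r₂ = a₂ , _} W-even H-even _ 2≤H _ r₂-on@(a₂≤W , _) c
  with m≤n⇒m<n∨m≡n a₂≤W
... | inj₁ a₂<W =
  unresolved-verticalPair (verticalPair-map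
    (λ c₂ → horizontal-sym (rightCone⇒horizontal (rightCone-trans c c₂)) ,
            horizontal-sym (rightCone⇒horizontal c₂))
    (pairRightOf W-even H-even 2≤H a₂<W r₂-on))
unresolved-rightCone {r₁ = zero , _}
  W-even H-even (s≤s (s≤s z≤n)) 2≤H r₁-on r₂-on (rightCone c) | inj₂ refl =
  unresolved-oppositeSides W-even H-even 2≤H r₁-on r₂-on (subst (_≤ _) (+-identityʳ _) c)

unresolved : parity W ≡ 0ℙ → parity H ≡ 0ℙ → 2 ≤ W → 2 ≤ H →
             OnBoard W H r₁ → OnBoard W H r₂ → Unresolved W H r₁ r₂
unresolved {r₁ = r₁} {r₂ = r₂} W-even H-even 2≤W 2≤H r₁-on r₂-on with cones-cover r₁ r₂
... | inj₁ (inj₁ c) = unresolved-rightCone W-even H-even 2≤W 2≤H r₁-on r₂-on c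
... | inj₁ (inj₂ c) = unresolved-swap (unresolved-rightCone W-even H-even 2≤W 2≤H r₂-on r₁-on c)
... | inj₂ (inj₁ c) = unresolved-transpose
  (unresolved-rightCone H-even W-even 2≤H 2≤W (onBoard-swap r₁-on) (onBoard-swap r₂-on) c)
... | inj₂ (inj₂ c) = unresolved-transpose (unresolved-swap
  (unresolved-rightCone H-even W-even 2≤H 2≤W (onBoard-swap r₂-on) (onBoard-swap r₁-on) c))

module _ {m n : ℕ} (1≤m : 1 ≤ m) (1≤n : 1 ≤ n) where

  Board : Point → Set
  Board = OnBoard (2 * n) (2 * m)

  chebWalk : ∀ k {s t} → Board s → Board t → cheb s t ≡ k → Walk m (suc n) s t k
  chebWalk zero s-on _ d≡0 =
    subst (λ t → Walk m (suc n) _ t 0) (cheb≡0⇒≡ d≡0) (here (onBoard⇒vertex s-on))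
  chebWalk (suc k) {x₁ , y₁} {x₂ , y₂} s-on@(x₁≤ , y₁≤ , e₁) t-on@(x₂≤ , y₂≤ , _) d≡
    with stepToward (≤-trans (s≤s z≤n) (*-monoʳ-≤ 2 1≤n)) x₁≤ x₂≤
                    (≤-trans (m≤m⊔n ∣ x₁ - x₂ ∣ ∣ y₁ - y₂ ∣) (≤-reflexive d≡))
                    (λ x≡ → n≢0⇒n>0 (λ k≡0 → column-cheb≢1 s-on t-on x≡ (trans d≡ (cong suc k≡0))))
       | stepToward (≤-trans (s≤s z≤n) (*-monoʳ-≤ 2 1≤m)) y₁≤ y₂≤
                    (≤-trans (m≤n⊔m ∣ x₁ - x₂ ∣ ∣ y₁ - y₂ ∣) (≤-reflexive d≡))
                    (λ y≡ → n≢0⇒n>0 (λ k≡0 → row-cheb≢1 s-on t-on y≡ (trans d≡ (cong suc k≡0))))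
  ... | x′ , x′≤ , x-step , x′-near | y′ , y′≤ , y-step , y′-near =
    step (onBoard⇒vertex s-on) (x-step , y-step)
         (chebWalk k u-on t-on (≤-antisym (⊔-lub x′-near y′-near) u-far))
    where
      s t u : Point
      s = x₁ , y₁
      t = x₂ , y₂
      u = x′ , y′
      u-on : Board u
      u-on = x′≤ , y′≤ , trans (∣m-n∣≡1⇒parity-flip x₁ x′ x-step)
                               (trans (cong _⁻¹ e₁) (sym (∣m-n∣≡1⇒parity-flip y₁ y′ y-step)))
      u-far : k ≤ cheb u t
      u-far = s≤s⁻¹ (begin
        suc k                ≡⟨ sym d≡ ⟩
        cheb s t             ≤⟨ cheb-triangle s u t ⟩
        cheb s u + cheb u t  ≡⟨ cong (_+ cheb u t) (cheb-adj {s} {u} (x-step , y-step)) ⟩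
        suc (cheb u t)       ∎)
        where open ≤-Reasoning

  dist⇒≡cheb : Board p → Board q → Dist m (suc n) p q k → k ≡ cheb p q
  dist⇒≡cheb p-on q-on (walk , shortest) =
    ≤-antisym (shortest _ (chebWalk _ p-on q-on refl)) (cheb≤length walk)

  dist-cheb : Board p → Board q → Dist m (suc n) p q (cheb p q)
  dist-cheb p-on q-on = chebWalk _ p-on q-on refl , λ _ walk → cheb≤length walk

  dist-transfer : Board p → Board q → Board r → cheb p r ≡ cheb q r →
                  Dist m (suc n) p r k → Dist m (suc n) q r k
  dist-transfer p-on q-on r-on same d =
    subst (Dist m (suc n) _ _) (sym (trans (dist⇒≡cheb p-on r-on d) same)) (dist-cheb q-on r-on)

  sameCode : All Board R → Board p → Board q →
             All (λ r → cheb p r ≡ cheb q r) R → SameCode m (suc n) R p q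
  sameCode R-on p-on q-on same = All.zipWith
    (λ (r-on , eq) k → dist-transfer p-on q-on r-on eq , dist-transfer q-on p-on r-on (sym eq))
    (R-on , same)

  ⊆-pair⇒¬resolving : Board r₁ → Board r₂ → R ⊆ r₁ ∷ r₂ ∷ [] → ¬ Resolving m (suc n) R
  ⊆-pair⇒¬resolving r₁-on r₂-on R⊆ (R-vertices , resolves) =
    s≢t (resolves s t (onBoard⇒vertex s-on) (onBoard⇒vertex t-on)
          (sameCode (All.map vertex⇒onBoard R-vertices) s-on t-on (All.tabulate equidistant)))
    where
      open Unresolved
        (unresolved (parity-double n) (parity-double m) (*-monoʳ-≤ 2 1≤n) (*-monoʳ-≤ 2 1≤m)
                    r₁-on r₂-on)
      equidistant : ∀ {r} → r ∈ _ → cheb s r ≡ cheb t r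
      equidistant r∈R with R⊆ r∈R
      ... | here refl         = same₁
      ... | there (here refl) = same₂

  resolving⇒2<length : Resolving m (suc n) R → 2 < length R
  resolving⇒2<length {[]} = ⊥-elim ∘ ⊆-pair⇒¬resolving origin origin (λ ())
    where
      origin : Board (0 , 0)
      origin = z≤n , z≤n , refl
  resolving⇒2<length {_ ∷ []} resolving@(r-vertex ∷ [] , _) =
    ⊥-elim (⊆-pair⇒¬resolving r-on r-on (λ { (here e) → here e }) resolving)
    where
      r-on : Board _
      r-on = vertex⇒onBoard r-vertex
  resolving⇒2<length {_ ∷ _ ∷ []} resolving@(r₁-vertex ∷ r₂-vertex ∷ [] , _) =
    ⊥-elim (⊆-pair⇒¬resolving (vertex⇒onBoard r₁-vertex) (vertex⇒onBoard r₂-vertex) id resolving)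
  resolving⇒2<length {_ ∷ _ ∷ _ ∷ _} _ = s≤s (s≤s (s≤s z≤n))

lemma5 : ∀ (m n : ℕ) → 1 ≤ m → m < n → n ≤ 2 * m + 1 →
         ∀ (R : List Point) → Unique R → Resolving m n R → 2 < length R
lemma5 m zero    _   ()         _ _ _
lemma5 m (suc n) 1≤m (s≤s m≤n) _ R _ = resolving⇒2<length 1≤m (≤-trans 1≤m m≤n)
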